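{- (a) There are $2^{\aleph_0}$-many pairwise $\trianglelefteq_{\mathsf{LO}}$-incomparable $\trianglelefteq_{\mathsf{LO}}$-minimal elements in $\mathsf{LO}$. In particular, if $\mathcal B$ is a basis for $\trianglelefteq_{\mathsf{LO}}$ then $|\mathcal B|=2^{\aleph_0}$. (b) There is a $\trianglelefteq_{\mathsf{LO}}$-decreasing $\omega$-sequence in $\mathsf{LO}$ which is not $\trianglelefteq_{\mathsf{LO}}$-bounded from below.
   Context: $\mathsf{LO}$ is the Polish space of codes $L\in 2^{\mathbb{N}\times\mathbb{N}}$ for reflexive linear orders on $\mathbb{N}$. For linear orders $L,L'$, $L\trianglelefteq L'$ iff there is an order embedding of $L$ into $L'$ whose image is convex in $L'$; $\trianglelefteq_{\mathsf{LO}}$ is its restriction to $\mathsf{LO}$. $L$ is $\trianglelefteq_{\mathsf{LO}}$-minimal if $L'\trianglelefteq_{\mathsf{LO}} L$ implies $L\trianglelefteq_{\mathsf{LO}} L'$ for all $L'\in\mathsf{LO}$. A basis for $\trianglelefteq_{\mathsf{LO}}$ is a collection $\mathcal B\subseteq\mathsf{LO}$ such that for every $L\in\mathsf{LO}$ there is $L'\in\mathcal B$ with $L'\trianglelefteq_{\mathsf{LO}} L$. A sequence is bounded from below if some $L\in\mathsf{LO}$ satisfies $L\trianglelefteq_{\mathsf{LO}}$ each member. -}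

module Defs where

open import Data.Nat using (ℕ)
open import Data.Bool using (Bool; true)
open import Data.Product using (Σ; ∃; _×_; proj₁)
open import Data.Sum using (_⊎_)
open import Relation.Binary.PropositionalEquality using (_≡_)
open import Relation.Nullary using (¬_)

Code : Set
Code = ℕ → ℕ → Bool

Rel : Code → ℕ → ℕ → Set
Rel L m n = L m n ≡ true

record IsLO (L : Code) : Set where
  field
    refl'   : ∀ n → Rel L n n
    antisym : ∀ m n → Rel L m n → Rel L n m → m ≡ n
    trans'  : ∀ m n k → Rel L m n → Rel L n k → Rel L m k
    total   : ∀ m n → Rel L m n ⊎ Rel L n m

LO : Set
LO = Σ Code IsLO

code : LO → Code
code = proj₁

IsOrderEmbedding : Code → Code → (ℕ → ℕ) → Set
IsOrderEmbedding L L' f =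
  ∀ m n → (Rel L m n → Rel L' (f m) (f n)) × (Rel L' (f m) (f n) → Rel L m n)

IsConvexImage : Code → (ℕ → ℕ) → Set
IsConvexImage L' f =
  ∀ m n k → Rel L' (f m) k → Rel L' k (f n) → ∃ λ j → f j ≡ k

_⊴_ : LO → LO → Set
L ⊴ L' = Σ (ℕ → ℕ) λ f →
  IsOrderEmbedding (code L) (code L') f × IsConvexImage (code L') f

Minimal : LO → Set
Minimal L = ∀ (L' : LO) → L' ⊴ L → L ⊴ L'

Incomparable : LO → LO → Set
Incomparable L L' = ¬ (L ⊴ L') × ¬ (L' ⊴ L)

IsBasis : (LO → Set) → Set
IsBasis B = ∀ (L : LO) → Σ LO λ L' → B L' × (L' ⊴ L)

_≐_ : LO → LO → Set
L ≐ L' = ∀ m n → code L m n ≡ code L' m n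

_≗₂_ : (ℕ → Bool) → (ℕ → Bool) → Set
x ≗₂ y = ∀ n → x n ≡ y n

-- |X| = 2^ℵ0 for a subset X ⊆ LO: injections both ways between X and 2^ℕ
-- (equality on X is equality of codes; cardinality equality by Cantor–Schröder–Bernstein)
HasContinuumSize : (LO → Set) → Set
HasContinuumSize X =
  (Σ ((ℕ → Bool) → Σ LO X) λ F →
     ∀ x y → proj₁ (F x) ≐ proj₁ (F y) → x ≗₂ y)
  × (Σ (Σ LO X → (ℕ → Bool)) λ G →
     ∀ a b → G a ≗₂ G b → proj₁ a ≐ proj₁ b)

StrictlyBelow : LO → LO → Set
StrictlyBelow L L' = (L ⊴ L') × ¬ (L' ⊴ L)

BoundedBelow : (ℕ → LO) → Set
BoundedBelow s = Σ LO λ L → ∀ n → L ⊴ s n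

{-# OPTIONS --safe #-}
-- Replace each node w of the complete binary tree, ordered in-order (a dense order without
-- endpoints), by a chain of t w + 1 points.  By density these chains are exactly the finite
-- condensation classes, and a convex embedding maps interior classes onto classes of the same
-- length.  The image of a convex embedding into such an order meets two nodes, hence contains a
-- whole subtree; so every order below it lies above the order given by t on some subtree.
--
-- (a) Label w by an injective code of (k , x k), where the drift k of w is its number of right
-- minus left turns (label 0 if k < 0).  Every subtree contains a subtree of drift 0, which
-- carries the full labelling, so the order M x is minimal; its class lengths recover x, so the
-- M x are pairwise incomparable.  A basis must contain an element below each M x, and these
-- elements are pairwise distinct.
--
-- (b) Label w by n plus its number of leading right turns.  The right subtree of the root gives
-- S (n + 1) ⊴ S n; the root's class of length n does not occur in S (n + 1); and a lower bound
-- would contain a class of some length k, which does not occur in S (k + 1).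

module Submission where

open import Defs
open import Data.Nat using (ℕ; zero; suc; _+_; _∸_; _≤_; _<_; z≤n; s≤s; _≟_)
open import Data.Nat.Properties
  using ( ≤-refl; ≤-trans; n≤1+n; n<1+n; ≤∧≢⇒<; <-irrefl; <⇒≢; <⇒≱; <⇒≤; ≤-pred
        ; +-suc; +-identityʳ; m≤n+m; m≤m+n; m+n∸m≡n; suc-injective; 1+n≰n )
open import Data.Integer using (ℤ; +_; -[1+_]; 0ℤ; 1ℤ; -1ℤ)
import Data.Integer as ℤ
import Data.Integer.Properties as ℤ
open import Data.Bool using (Bool; true; false; not)
open import Data.Bool.Properties using () renaming (_≟_ to _≟ᵇ_)
open import Data.List using (List; []; _∷_; _++_; map; replicate)
open import Data.List.Properties using (++-assoc; ≡-dec)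
open import Data.Fin using (Fin; toℕ; fromℕ<)
open import Data.Fin.Properties using (pigeonhole; toℕ-fromℕ<; ¬∀⟶∃¬)
open import Data.Product using (Σ; ∃; ∃₂; _×_; _,_; proj₁; proj₂)
open import Data.Sum using (_⊎_; inj₁; inj₂)
open import Data.Empty using (⊥-elim)
open import Relation.Nullary using (¬_; Dec; yes; no)
open import Relation.Binary.PropositionalEquality
  using (_≡_; _≢_; _≗_; refl; sym; trans; cong; cong₂; subst)
open Relation.Binary.PropositionalEquality.≡-Reasoning

-- Finite condensation classes and convex embeddings

Lt : Code → ℕ → ℕ → Set
Lt C a b = Rel C a b × a ≢ b

Covers : Code → ℕ → ℕ → Set
Covers C a b = Lt C a b × (∀ z → Lt C a z → ¬ Lt C z b)

HasNoPred : Code → ℕ → Set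
HasNoPred C b = ∀ a → ¬ Covers C a b

HasNoSucc : Code → ℕ → Set
HasNoSucc C a = ∀ b → ¬ Covers C a b

-- A finite condensation class e 0 ⋖ e 1 ⋖ ⋯ ⋖ e k of length k (and k + 1 points).
IsFiniteClass : Code → ℕ → (ℕ → ℕ) → Set
IsFiniteClass C k e =
  (∀ i → i < k → Covers C (e i) (e (suc i))) × HasNoPred C (e 0) × HasNoSucc C (e k)

-- Classes with points on both sides are what convex embeddings preserve; a class at an end
-- of the order may be prolonged in a larger order.
IsInteriorFiniteClass : Code → ℕ → (ℕ → ℕ) → Set
IsInteriorFiniteClass C k e =
  IsFiniteClass C k e × (∃ λ a → Lt C a (e 0)) × (∃ λ b → Lt C (e k) b)

HasInteriorFiniteClass : LO → ℕ → Set
HasInteriorFiniteClass L k = Σ (ℕ → ℕ) (IsInteriorFiniteClass (code L) k)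

module _ {C : Code} (isC : IsLO C) where
  open IsLO isC

  ≡⇒Rel : ∀ {a b} → a ≡ b → Rel C a b
  ≡⇒Rel {a} refl = refl' a

  Lt⇒pred≥ : ∀ {a b z} → Lt C a b → Covers C z b → Rel C a z
  Lt⇒pred≥ {a} {b} {z} a<b (z<b , nothing-between) with total a z | a ≟ z
  ... | inj₁ a≤z | _     = a≤z
  ... | inj₂ _   | yes e = ≡⇒Rel e
  ... | inj₂ z≤a | no ne = ⊥-elim (nothing-between a (z≤a , λ e → ne (sym e)) a<b)

  Lt⇒succ≤ : ∀ {a b z} → Lt C a b → Covers C a z → Rel C z b
  Lt⇒succ≤ {a} {b} {z} a<b (a<z , nothing-between) with total z b | z ≟ b
  ... | inj₁ z≤b | _     = z≤b
  ... | inj₂ _   | yes e = ≡⇒Rel e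
  ... | inj₂ b≤z | no ne = ⊥-elim (nothing-between b a<b (b≤z , λ e → ne (sym e)))

IsConvexEmbedding : Code → Code → (ℕ → ℕ) → Set
IsConvexEmbedding C D f = IsOrderEmbedding C D f × IsConvexImage D f

module ConvexEmbedding {C D : Code} (isC : IsLO C) (isD : IsLO D) {f : ℕ → ℕ}
                       (emb : IsConvexEmbedding C D f) where
  private
    module C = IsLO isC
    module D = IsLO isD

    preserves : ∀ m n → Rel C m n → Rel D (f m) (f n)
    preserves m n = proj₁ (proj₁ emb m n)

    reflects : ∀ m n → Rel D (f m) (f n) → Rel C m n
    reflects m n = proj₂ (proj₁ emb m n)

    convex : IsConvexImage D f
    convex = proj₂ emb

  injective : ∀ a b → f a ≡ f b → a ≡ b
  injective a b e = C.antisym a b (reflects a b (subst (Rel D (f a)) e (D.refl' (f a))))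
                                  (reflects b a (subst (λ z → Rel D z (f a)) e (D.refl' (f a))))

  Lt-preserve : ∀ a b → Lt C a b → Lt D (f a) (f b)
  Lt-preserve a b (a≤b , a≢b) = preserves a b a≤b , λ e → a≢b (injective a b e)

  Lt-reflect : ∀ a b → Lt D (f a) (f b) → Lt C a b
  Lt-reflect a b (fa≤fb , fa≢fb) = reflects a b fa≤fb , λ e → fa≢fb (cong f e)

  Covers-preserve : ∀ a b → Covers C a b → Covers D (f a) (f b)
  Covers-preserve a b (a<b , nothing-between) = Lt-preserve a b a<b , between-in-image
    where
    between-in-image : ∀ z → Lt D (f a) z → ¬ Lt D z (f b)
    between-in-image z fa<z z<fb with convex a b z (proj₁ fa<z) (proj₁ z<fb)
    ... | j , refl = nothing-between j (Lt-reflect a j fa<z) (Lt-reflect j b z<fb)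

  Covers-reflect : ∀ a b → Covers D (f a) (f b) → Covers C a b
  Covers-reflect a b (fa<fb , nothing-between) =
    Lt-reflect a b fa<fb , λ z a<z z<b → nothing-between (f z) (Lt-preserve a z a<z) (Lt-preserve z b z<b)

  HasNoPred-preserve : ∀ {a} b → Lt C a b → HasNoPred C b → HasNoPred D (f b)
  HasNoPred-preserve {a} b a<b no-pred z z⋖fb
    with convex a b z (Lt⇒pred≥ isD (Lt-preserve a b a<b) z⋖fb) (proj₁ (proj₁ z⋖fb))
  ... | j , refl = no-pred j (Covers-reflect j b z⋖fb)

  HasNoSucc-preserve : ∀ a {b} → Lt C a b → HasNoSucc C a → HasNoSucc D (f a)
  HasNoSucc-preserve a {b} a<b no-succ z fa⋖z
    with convex a b z (proj₁ (proj₁ fa⋖z)) (Lt⇒succ≤ isD (Lt-preserve a b a<b) fa⋖z)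
  ... | j , refl = no-succ j (Covers-reflect a j fa⋖z)

  IsInteriorFiniteClass-preserve : ∀ k e → IsInteriorFiniteClass C k e →
                                   IsInteriorFiniteClass D k (λ i → f (e i))
  IsInteriorFiniteClass-preserve k e ((covers , no-pred , no-succ) , (a , a<e₀) , (b , eₖ<b)) =
    ( (λ i i<k → Covers-preserve _ _ (covers i i<k))
    , HasNoPred-preserve (e 0) a<e₀ no-pred
    , HasNoSucc-preserve (e k) eₖ<b no-succ )
    , (f a , Lt-preserve a (e 0) a<e₀) , (f b , Lt-preserve (e k) b eₖ<b)

⊴-trans : ∀ {A B C : LO} → A ⊴ B → B ⊴ C → A ⊴ C
⊴-trans {A} {B} {C} (f , f-ord , f-conv) (g , g-ord , g-conv) =
  (λ m → g (f m)) , ordered , convex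
  where
  ordered : IsOrderEmbedding (code A) (code C) (λ m → g (f m))
  ordered m n = (λ r → proj₁ (g-ord (f m) (f n)) (proj₁ (f-ord m n) r))
              , (λ r → proj₂ (f-ord m n) (proj₂ (g-ord (f m) (f n)) r))
  convex : IsConvexImage (code C) (λ m → g (f m))
  convex m n k gfm≤k k≤gfn with g-conv (f m) (f n) k gfm≤k k≤gfn
  ... | j , refl with f-conv m n j (proj₂ (g-ord (f m) j) gfm≤k) (proj₂ (g-ord j (f n)) k≤gfn)
  ...   | i , refl = i , refl

⊴-pullback : ∀ {A B C : LO} {h f : ℕ → ℕ} →
             IsConvexEmbedding (code A) (code B) h → IsConvexEmbedding (code C) (code B) f →
             (∀ m → ∃ λ j → f j ≡ h m) → A ⊴ C
⊴-pullback {A} {B} {C} {h} {f} (h-ord , h-conv) f-emb@(f-ord , _) preimage =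
  g , ordered , convex
  where
  g : ℕ → ℕ
  g m = proj₁ (preimage m)
  fg≡h : ∀ m → f (g m) ≡ h m
  fg≡h m = proj₂ (preimage m)
  Rel-cong : ∀ {a b c d} → a ≡ c → b ≡ d → Rel (code B) c d → Rel (code B) a b
  Rel-cong refl refl r = r
  ordered : IsOrderEmbedding (code A) (code C) g
  ordered m n = (λ r → proj₂ (f-ord (g m) (g n)) (Rel-cong (fg≡h m) (fg≡h n) (proj₁ (h-ord m n) r)))
              , (λ r → proj₂ (h-ord m n) (Rel-cong (sym (fg≡h m)) (sym (fg≡h n)) (proj₁ (f-ord (g m) (g n)) r)))
  convex : IsConvexImage (code C) g
  convex m n k gm≤k k≤gn with h-conv m n (f k)
                                 (subst (λ x → Rel (code B) x (f k)) (fg≡h m) (proj₁ (f-ord (g m) k) gm≤k))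
                                 (subst (Rel (code B) (f k)) (fg≡h n) (proj₁ (f-ord k (g n)) k≤gn))
  ... | j , hj≡fk = j , ConvexEmbedding.injective (proj₂ C) (proj₂ B) f-emb (g j) k (trans (fg≡h j) hj≡fk)

HasInteriorFiniteClass-⊴ : ∀ {L L′ : LO} {k} → L ⊴ L′ →
                           HasInteriorFiniteClass L k → HasInteriorFiniteClass L′ k
HasInteriorFiniteClass-⊴ {L} {L′} {k} (f , emb) (e , class) =
  (λ i → f (e i)) , ConvexEmbedding.IsInteriorFiniteClass-preserve (proj₂ L) (proj₂ L′) emb k e class

data Cmp : Set where
  lt eq gt : Cmp

opposite : Cmp → Cmp
opposite lt = gt
opposite eq = eq
opposite gt = lt

isLeq : Cmp → Bool
isLeq lt = true
isLeq eq = true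
isLeq gt = false

lex : Cmp → Cmp → Cmp
lex lt _ = lt
lex eq c = c
lex gt _ = gt

isLeq-lex : ∀ a b → isLeq (lex a b) ≡ true → isLeq a ≡ true
isLeq-lex lt b _ = refl
isLeq-lex eq b _ = refl

record IsComparison {A : Set} (c : A → A → Cmp) : Set where
  field
    eq-refl       : ∀ a → c a a ≡ eq
    eq⇒≡          : ∀ a b → c a b ≡ eq → a ≡ b
    swap-opposite : ∀ a b → c b a ≡ opposite (c a b)
    lt-trans      : ∀ a b d → c a b ≡ lt → c b d ≡ lt → c a d ≡ lt

  lt-irrefl : ∀ a → c a a ≢ lt
  lt-irrefl a e with trans (sym e) (eq-refl a)
  ... | ()

  lt-asym : ∀ a b → c a b ≡ lt → c b a ≢ lt
  lt-asym a b e e′ = lt-irrefl a (lt-trans a b a e e′)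

module FromComparison {A : Set} {c : A → A → Cmp} (isCmp : IsComparison c)
                      (point : ℕ → A) (point-injective : ∀ m n → point m ≡ point n → m ≡ n) where
  open IsComparison isCmp

  ord : Code
  ord m n = isLeq (c (point m) (point n))

  private
    leq-antisym : ∀ a b → isLeq (c a b) ≡ true → isLeq (c b a) ≡ true → a ≡ b
    leq-antisym a b p q rewrite swap-opposite a b with c a b in e
    ... | eq = eq⇒≡ a b e
    leq-antisym a b () q | gt
    leq-antisym a b p () | lt

    leq-trans : ∀ a b d → isLeq (c a b) ≡ true → isLeq (c b d) ≡ true → isLeq (c a d) ≡ true
    leq-trans a b d p q with c a b in e₁ | c b d in e₂
    ... | lt | lt rewrite lt-trans a b d e₁ e₂ = refl
    ... | eq | _  rewrite eq⇒≡ a b e₁ | e₂ = q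
    ... | lt | eq rewrite eq⇒≡ b d e₂ | e₁ = refl
    leq-trans a b d () q | gt | _
    leq-trans a b d p () | lt | gt

    leq-total : ∀ a b → isLeq (c a b) ≡ true ⊎ isLeq (c b a) ≡ true
    leq-total a b rewrite swap-opposite a b with c a b
    ... | lt = inj₁ refl
    ... | eq = inj₁ refl
    ... | gt = inj₂ refl

  isLO : IsLO ord
  isLO = record
    { refl'   = λ n → cong isLeq (eq-refl (point n))
    ; antisym = λ m n p q → point-injective m n (leq-antisym (point m) (point n) p q)
    ; trans'  = λ m n k → leq-trans (point m) (point n) (point k)
    ; total   = λ m n → leq-total (point m) (point n)
    }

  lo : LO
  lo = ord , isLO

  lt⇒Lt : ∀ m n → c (point m) (point n) ≡ lt → Lt ord m n
  lt⇒Lt m n e = cong isLeq e , λ { refl → lt-irrefl (point m) e }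

  Lt⇒lt : ∀ m n → Lt ord m n → c (point m) (point n) ≡ lt
  Lt⇒lt m n (m≤n , m≢n) with c (point m) (point n) in e
  ... | lt = refl
  ... | eq = ⊥-elim (m≢n (point-injective m n (eq⇒≡ _ _ e)))
  Lt⇒lt m n (() , _) | gt

cmpℕ : ℕ → ℕ → Cmp
cmpℕ zero    zero    = eq
cmpℕ zero    (suc _) = lt
cmpℕ (suc _) zero    = gt
cmpℕ (suc m) (suc n) = cmpℕ m n

cmpℕ-isComparison : IsComparison cmpℕ
cmpℕ-isComparison = record
  { eq-refl = eq-refl ; eq⇒≡ = eq⇒≡ ; swap-opposite = swap-opposite ; lt-trans = lt-trans′ }
  where
  eq-refl : ∀ a → cmpℕ a a ≡ eq
  eq-refl zero    = refl
  eq-refl (suc a) = eq-refl a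
  eq⇒≡ : ∀ a b → cmpℕ a b ≡ eq → a ≡ b
  eq⇒≡ zero    zero    _ = refl
  eq⇒≡ (suc a) (suc b) e = cong suc (eq⇒≡ a b e)
  eq⇒≡ zero    (suc b) ()
  eq⇒≡ (suc a) zero    ()
  swap-opposite : ∀ a b → cmpℕ b a ≡ opposite (cmpℕ a b)
  swap-opposite zero    zero    = refl
  swap-opposite zero    (suc b) = refl
  swap-opposite (suc a) zero    = refl
  swap-opposite (suc a) (suc b) = swap-opposite a b
  lt-trans′ : ∀ a b d → cmpℕ a b ≡ lt → cmpℕ b d ≡ lt → cmpℕ a d ≡ lt
  lt-trans′ zero    (suc b) (suc d) _ _ = refl
  lt-trans′ (suc a) (suc b) (suc d) p q = lt-trans′ a b d p q
  lt-trans′ zero    zero    _       () _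
  lt-trans′ (suc a) zero    _       () _
  lt-trans′ _       (suc b) zero    _ ()

cmpℕ-lt⇒< : ∀ a b → cmpℕ a b ≡ lt → a < b
cmpℕ-lt⇒< zero    (suc b) _ = s≤s z≤n
cmpℕ-lt⇒< (suc a) (suc b) e = s≤s (cmpℕ-lt⇒< a b e)
cmpℕ-lt⇒< zero    zero    ()
cmpℕ-lt⇒< (suc a) zero    ()

<⇒cmpℕ-lt : ∀ {a b} → a < b → cmpℕ a b ≡ lt
<⇒cmpℕ-lt {zero}  {suc b} _         = refl
<⇒cmpℕ-lt {suc a} {suc b} (s≤s a<b) = <⇒cmpℕ-lt a<b

cmp× : {A B : Set} → (A → A → Cmp) → (B → B → Cmp) → A × B → A × B → Cmp
cmp× c d (a , b) (a′ , b′) = lex (c a a′) (d b b′)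

module _ {A B : Set} {c : A → A → Cmp} {d : B → B → Cmp}
         (isC : IsComparison c) (isD : IsComparison d) where
  private
    module C = IsComparison isC
    module D = IsComparison isD

  cmp×-lt : ∀ a b a′ b′ → cmp× c d (a , b) (a′ , b′) ≡ lt → c a a′ ≡ lt ⊎ (a ≡ a′ × d b b′ ≡ lt)
  cmp×-lt a b a′ b′ e with c a a′ in e₁
  ... | lt = inj₁ refl
  ... | eq = inj₂ (C.eq⇒≡ a a′ e₁ , e)

  cmp×-lt₁ : ∀ a b a′ b′ → c a a′ ≡ lt → cmp× c d (a , b) (a′ , b′) ≡ lt
  cmp×-lt₁ a b a′ b′ e rewrite e = refl

  cmp×-lt₂ : ∀ a b b′ → d b b′ ≡ lt → cmp× c d (a , b) (a , b′) ≡ lt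
  cmp×-lt₂ a b b′ e rewrite C.eq-refl a = e

  cmp×-isComparison : IsComparison (cmp× c d)
  cmp×-isComparison = record
    { eq-refl = eq-refl ; eq⇒≡ = eq⇒≡ ; swap-opposite = swap-opposite ; lt-trans = lt-trans }
    where
    eq-refl : ∀ p → cmp× c d p p ≡ eq
    eq-refl (a , b) rewrite C.eq-refl a = D.eq-refl b
    eq⇒≡ : ∀ p q → cmp× c d p q ≡ eq → p ≡ q
    eq⇒≡ (a , b) (a′ , b′) e with c a a′ in e₁
    ... | eq = cong₂ _,_ (C.eq⇒≡ a a′ e₁) (D.eq⇒≡ b b′ e)
    swap-opposite : ∀ p q → cmp× c d q p ≡ opposite (cmp× c d p q)
    swap-opposite (a , b) (a′ , b′) rewrite C.swap-opposite a a′ | D.swap-opposite b b′ with c a a′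
    ... | lt = refl
    ... | eq = refl
    ... | gt = refl
    lt-trans : ∀ p q r → cmp× c d p q ≡ lt → cmp× c d q r ≡ lt → cmp× c d p r ≡ lt
    lt-trans (a , b) (a′ , b′) (a″ , b″) p q with cmp×-lt a b a′ b′ p | cmp×-lt a′ b′ a″ b″ q
    ... | inj₁ p₁          | inj₁ q₁          = cmp×-lt₁ a b a″ b″ (C.lt-trans a a′ a″ p₁ q₁)
    ... | inj₁ p₁          | inj₂ (refl , _)  = cmp×-lt₁ a b a″ b″ p₁
    ... | inj₂ (refl , _)  | inj₁ q₁          = cmp×-lt₁ a b a″ b″ q₁
    ... | inj₂ (refl , p₂) | inj₂ (refl , q₂) = cmp×-lt₂ a b b″ (D.lt-trans b b′ b″ p₂ q₂)

-- The in-order binary tree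

-- Words are the nodes of the complete binary tree (false = left, true = right), compared
-- in-order: the left subtree of a node, then the node, then its right subtree.  This is a
-- dense order without endpoints.
W : Set
W = List Bool

cmpW : W → W → Cmp
cmpW []          []          = eq
cmpW []          (false ∷ v) = gt
cmpW []          (true ∷ v)  = lt
cmpW (false ∷ u) []          = lt
cmpW (true ∷ u)  []          = gt
cmpW (false ∷ u) (false ∷ v) = cmpW u v
cmpW (false ∷ u) (true ∷ v)  = lt
cmpW (true ∷ u)  (false ∷ v) = gt
cmpW (true ∷ u)  (true ∷ v)  = cmpW u v

cmpW-isComparison : IsComparison cmpW
cmpW-isComparison = record
  { eq-refl = eq-refl ; eq⇒≡ = eq⇒≡ ; swap-opposite = swap-opposite ; lt-trans = lt-trans }
  where
  eq-refl : ∀ u → cmpW u u ≡ eq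
  eq-refl []          = refl
  eq-refl (false ∷ u) = eq-refl u
  eq-refl (true ∷ u)  = eq-refl u
  eq⇒≡ : ∀ u v → cmpW u v ≡ eq → u ≡ v
  eq⇒≡ []          []          _ = refl
  eq⇒≡ (false ∷ u) (false ∷ v) e = cong (false ∷_) (eq⇒≡ u v e)
  eq⇒≡ (true ∷ u)  (true ∷ v)  e = cong (true ∷_) (eq⇒≡ u v e)
  eq⇒≡ []          (false ∷ v) ()
  eq⇒≡ []          (true ∷ v)  ()
  eq⇒≡ (false ∷ u) []          ()
  eq⇒≡ (true ∷ u)  []          ()
  eq⇒≡ (false ∷ u) (true ∷ v)  ()
  eq⇒≡ (true ∷ u)  (false ∷ v) ()
  swap-opposite : ∀ u v → cmpW v u ≡ opposite (cmpW u v)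
  swap-opposite []          []          = refl
  swap-opposite []          (false ∷ v) = refl
  swap-opposite []          (true ∷ v)  = refl
  swap-opposite (false ∷ u) []          = refl
  swap-opposite (true ∷ u)  []          = refl
  swap-opposite (false ∷ u) (false ∷ v) = swap-opposite u v
  swap-opposite (false ∷ u) (true ∷ v)  = refl
  swap-opposite (true ∷ u)  (false ∷ v) = refl
  swap-opposite (true ∷ u)  (true ∷ v)  = swap-opposite u v
  lt-trans : ∀ u v w → cmpW u v ≡ lt → cmpW v w ≡ lt → cmpW u w ≡ lt
  lt-trans []          (true ∷ v)  (true ∷ w)  _ _ = refl
  lt-trans (false ∷ u) []          (true ∷ w)  _ _ = refl
  lt-trans (false ∷ u) (false ∷ v) []          _ _ = refl
  lt-trans (false ∷ u) (false ∷ v) (false ∷ w) p q = lt-trans u v w p q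
  lt-trans (false ∷ u) (false ∷ v) (true ∷ w)  _ _ = refl
  lt-trans (false ∷ u) (true ∷ v)  (true ∷ w)  _ _ = refl
  lt-trans (true ∷ u)  (true ∷ v)  (true ∷ w)  p q = lt-trans u v w p q
  lt-trans []          []          _           () _
  lt-trans []          (false ∷ _) _           () _
  lt-trans []          (true ∷ v)  []          _ ()
  lt-trans []          (true ∷ v)  (false ∷ _) _ ()
  lt-trans (false ∷ u) []          []          _ ()
  lt-trans (false ∷ u) []          (false ∷ _) _ ()
  lt-trans (false ∷ u) (true ∷ v)  []          _ ()
  lt-trans (false ∷ u) (true ∷ v)  (false ∷ w) _ ()
  lt-trans (true ∷ u)  []          _           () _
  lt-trans (true ∷ u)  (false ∷ _) _           () _
  lt-trans (true ∷ u)  (true ∷ v)  []          _ ()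
  lt-trans (true ∷ u)  (true ∷ v)  (false ∷ _) _ ()

cmpW-++ : ∀ p u v → cmpW (p ++ u) (p ++ v) ≡ cmpW u v
cmpW-++ []          u v = refl
cmpW-++ (false ∷ p) u v = cmpW-++ p u v
cmpW-++ (true ∷ p)  u v = cmpW-++ p u v

<-rightSubtree : ∀ u x → cmpW u (u ++ true ∷ x) ≡ lt
<-rightSubtree []          x = refl
<-rightSubtree (false ∷ u) x = <-rightSubtree u x
<-rightSubtree (true ∷ u)  x = <-rightSubtree u x

leftSubtree-< : ∀ u x → cmpW (u ++ false ∷ x) u ≡ lt
leftSubtree-< []          x = refl
leftSubtree-< (false ∷ u) x = leftSubtree-< u x
leftSubtree-< (true ∷ u)  x = leftSubtree-< u x

SubtreeBetween : W → W → W → Set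
SubtreeBetween u v q = ∀ x → cmpW u (q ++ x) ≡ lt × cmpW (q ++ x) v ≡ lt

-- Between u < v lies the right subtree of u, unless v lies in it; then the left subtree of v does.
subtree-between : ∀ u v → cmpW u v ≡ lt → ∃ (SubtreeBetween u v)
subtree-between []          (true ∷ v)  _ = true ∷ v ++ false ∷ [] , λ x →
  refl , subst (λ y → cmpW y v ≡ lt) (sym (++-assoc v (false ∷ []) x)) (leftSubtree-< v x)
subtree-between (false ∷ u) []          _ = false ∷ u ++ true ∷ [] , λ x →
  subst (λ y → cmpW u y ≡ lt) (sym (++-assoc u (true ∷ []) x)) (<-rightSubtree u x) , refl
subtree-between (false ∷ u) (true ∷ v)  _ = false ∷ u ++ true ∷ [] , λ x →
  subst (λ y → cmpW u y ≡ lt) (sym (++-assoc u (true ∷ []) x)) (<-rightSubtree u x) , refl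
subtree-between (false ∷ u) (false ∷ v) e with subtree-between u v e
... | q , between = false ∷ q , between
subtree-between (true ∷ u)  (true ∷ v)  e with subtree-between u v e
... | q , between = true ∷ q , between
subtree-between []          []          ()
subtree-between []          (false ∷ v) ()
subtree-between (true ∷ u)  []          ()
subtree-between (true ∷ u)  (false ∷ v) ()

subtree-convex : ∀ p u v z → isLeq (cmpW (p ++ u) z) ≡ true → isLeq (cmpW z (p ++ v)) ≡ true →
                 ∃ λ z′ → z ≡ p ++ z′
subtree-convex []          u v z           _ _ = z , refl
subtree-convex (false ∷ p) u v (false ∷ z) l r with subtree-convex p u v z l r
... | z′ , refl = z′ , refl
subtree-convex (true ∷ p)  u v (true ∷ z)  l r with subtree-convex p u v z l r
... | z′ , refl = z′ , refl
subtree-convex (false ∷ p) u v []          _ ()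
subtree-convex (false ∷ p) u v (true ∷ z)  _ ()
subtree-convex (true ∷ p)  u v []          () _
subtree-convex (true ∷ p)  u v (false ∷ z) () _

-- The bijection between ℕ and {(u , i) ∣ i ≤ t u} listing the pairs lexicographically.
module SumEnumeration (t : ℕ → ℕ) where

  offset : ℕ → ℕ
  offset zero    = 0
  offset (suc u) = offset u + suc (t u)

  rank : ℕ × ℕ → ℕ
  rank (u , i) = offset u + i

  private
    next′ : ∀ u i → Dec (i ≡ t u) → ℕ × ℕ
    next′ u i (yes _) = suc u , 0
    next′ u i (no _)  = u , suc i

  next : ℕ × ℕ → ℕ × ℕ
  next (u , i) = next′ u i (i ≟ t u)

  unrank : ℕ → ℕ × ℕ
  unrank zero    = 0 , 0
  unrank (suc n) = next (unrank n)

  Valid : ℕ × ℕ → Set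
  Valid (u , i) = i ≤ t u

  rank-next : ∀ p → rank (next p) ≡ suc (rank p)
  rank-next (u , i) with i ≟ t u
  ... | yes refl = trans (+-identityʳ (offset u + suc i)) (+-suc (offset u) i)
  ... | no _     = +-suc (offset u) i

  rank-unrank : ∀ n → rank (unrank n) ≡ n
  rank-unrank zero    = refl
  rank-unrank (suc n) = trans (rank-next (unrank n)) (cong suc (rank-unrank n))

  unrank-valid : ∀ n → Valid (unrank n)
  unrank-valid zero = z≤n
  unrank-valid (suc n) = next-valid (unrank n) (unrank-valid n)
    where
    next-valid : ∀ p → Valid p → Valid (next p)
    next-valid (u , i) i≤t with i ≟ t u
    ... | yes _   = z≤n
    ... | no  i≢t = ≤∧≢⇒< i≤t i≢t

  unrank-rank : ∀ u i → i ≤ t u → unrank (rank (u , i)) ≡ (u , i)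
  unrank-rank u zero _ = trans (cong unrank (+-identityʳ (offset u))) (unrank-offset u)
    where
    unrank-offset : ∀ u → unrank (offset u) ≡ (u , 0)
    unrank-offset zero    = refl
    unrank-offset (suc u) = begin
      unrank (offset u + suc (t u))  ≡⟨ cong unrank (+-suc (offset u) (t u)) ⟩
      next (unrank (offset u + t u)) ≡⟨ cong next (unrank-rank u (t u) ≤-refl) ⟩
      next (u , t u)                 ≡⟨ next-last ⟩
      suc u , 0                      ∎
      where
      next-last : next (u , t u) ≡ (suc u , 0)
      next-last with t u ≟ t u
      ... | yes _ = refl
      ... | no ne = ⊥-elim (ne refl)
  unrank-rank u (suc i) i<t = begin
    unrank (offset u + suc i)  ≡⟨ cong unrank (+-suc (offset u) i) ⟩
    next (unrank (offset u + i)) ≡⟨ cong next (unrank-rank u i (≤-trans (n≤1+n i) i<t)) ⟩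
    next (u , i)               ≡⟨ next-inner ⟩
    u , suc i                  ∎
    where
    next-inner : next (u , i) ≡ (u , suc i)
    next-inner with i ≟ t u
    ... | yes i≡t = ⊥-elim (<⇒≢ i<t i≡t)
    ... | no _    = refl

-- Bijective base-2 numeration: false and true are the digits 1 and 2, least significant first.
encodeW : W → ℕ
encodeW []          = 0
encodeW (false ∷ w) = suc (encodeW w + encodeW w)
encodeW (true ∷ w)  = suc (suc (encodeW w + encodeW w))

incrementW : W → W
incrementW []          = false ∷ []
incrementW (false ∷ w) = true ∷ w
incrementW (true ∷ w)  = false ∷ incrementW w

decodeW : ℕ → W
decodeW zero    = []
decodeW (suc n) = incrementW (decodeW n)

encodeW-increment : ∀ w → encodeW (incrementW w) ≡ suc (encodeW w)
encodeW-increment []          = refl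
encodeW-increment (false ∷ w) = refl
encodeW-increment (true ∷ w)  rewrite encodeW-increment w | +-suc (encodeW w) (encodeW w) = refl

encodeW-decodeW : ∀ n → encodeW (decodeW n) ≡ n
encodeW-decodeW zero    = refl
encodeW-decodeW (suc n) = trans (encodeW-increment (decodeW n)) (cong suc (encodeW-decodeW n))

decodeW-odd  : ∀ n → decodeW (suc (n + n)) ≡ false ∷ decodeW n
decodeW-even : ∀ n → decodeW (suc (suc (n + n))) ≡ true ∷ decodeW n
decodeW-odd zero     = refl
decodeW-odd (suc n)  rewrite +-suc n n = cong incrementW (decodeW-even n)
decodeW-even zero    = refl
decodeW-even (suc n) = cong incrementW (decodeW-odd (suc n))

decodeW-encodeW : ∀ w → decodeW (encodeW w) ≡ w
decodeW-encodeW []          = refl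
decodeW-encodeW (false ∷ w) = trans (decodeW-odd (encodeW w)) (cong (false ∷_) (decodeW-encodeW w))
decodeW-encodeW (true ∷ w)  = trans (decodeW-even (encodeW w)) (cong (true ∷_) (decodeW-encodeW w))

-- Replacing the nodes of the tree by finite chains

cmpP : W × ℕ → W × ℕ → Cmp
cmpP = cmp× cmpW cmpℕ

cmpP-isComparison : IsComparison cmpP
cmpP-isComparison = cmp×-isComparison cmpW-isComparison cmpℕ-isComparison

cmpP-lt : ∀ w i v j → cmpP (w , i) (v , j) ≡ lt → cmpW w v ≡ lt ⊎ (w ≡ v × i < j)
cmpP-lt w i v j e with cmp×-lt cmpW-isComparison cmpℕ-isComparison w i v j e
... | inj₁ w<v        = inj₁ w<v
... | inj₂ (w≡v , i<j) = inj₂ (w≡v , cmpℕ-lt⇒< i j i<j)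

cmpP-node< : ∀ w i v j → cmpW w v ≡ lt → cmpP (w , i) (v , j) ≡ lt
cmpP-node< = cmp×-lt₁ cmpW-isComparison cmpℕ-isComparison

cmpP-level< : ∀ w i j → i < j → cmpP (w , i) (w , j) ≡ lt
cmpP-level< w i j i<j = cmp×-lt₂ cmpW-isComparison cmpℕ-isComparison w i j (<⇒cmpℕ-lt i<j)

module Blocks (t : W → ℕ) where
  private
    module E = SumEnumeration (λ n → t (decodeW n))
    module Wc = IsComparison cmpW-isComparison

  point : ℕ → W × ℕ
  point n = decodeW (proj₁ (E.unrank n)) , proj₂ (E.unrank n)

  node : ℕ → W
  node n = proj₁ (point n)

  level : ℕ → ℕ
  level n = proj₂ (point n)

  index : W × ℕ → ℕ
  index (w , i) = E.rank (encodeW w , i)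

  level≤ : ∀ n → level n ≤ t (node n)
  level≤ n = E.unrank-valid n

  point-index : ∀ w i → i ≤ t w → point (index (w , i)) ≡ (w , i)
  point-index w i i≤t
    with E.unrank-rank (encodeW w) i (subst (λ v → i ≤ t v) (sym (decodeW-encodeW w)) i≤t)
  ... | e = cong₂ _,_ (trans (cong (λ p → decodeW (proj₁ p)) e) (decodeW-encodeW w)) (cong proj₂ e)

  index-point : ∀ n → index (point n) ≡ n
  index-point n =
    trans (cong (λ u → E.rank (u , level n)) (encodeW-decodeW (proj₁ (E.unrank n)))) (E.rank-unrank n)

  point-injective : ∀ m n → point m ≡ point n → m ≡ n
  point-injective m n e = trans (sym (index-point m)) (trans (cong index e) (index-point n))

  open FromComparison cmpP-isComparison point point-injective public

  Lt-at : ∀ {m n p q} → point m ≡ p → point n ≡ q → cmpP p q ≡ lt → Lt ord m n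
  Lt-at refl refl = lt⇒Lt _ _

  lt-at : ∀ {m n p q} → point m ≡ p → point n ≡ q → Lt ord m n → cmpP p q ≡ lt
  lt-at refl refl = Lt⇒lt _ _

  nothing-between-levels : ∀ w i p → cmpP (w , i) p ≡ lt → ¬ cmpP p (w , suc i) ≡ lt
  nothing-between-levels w i (v , j) l r with cmpP-lt w i v j l | cmpP-lt v j w (suc i) r
  ... | inj₁ w<v          | inj₁ v<w         = Wc.lt-asym w v w<v v<w
  ... | inj₁ w<v          | inj₂ (refl , _)  = Wc.lt-irrefl v w<v
  ... | inj₂ (refl , _)   | inj₁ v<w         = Wc.lt-irrefl w v<w
  ... | inj₂ (refl , i<j) | inj₂ (_ , j<1+i) = <⇒≱ i<j (≤-pred j<1+i)

  covers-successor : ∀ w i → suc i ≤ t w → Covers ord (index (w , i)) (index (w , suc i))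
  covers-successor w i i<t =
    Lt-at wi w1+i (cmpP-level< w i (suc i) ≤-refl) ,
    λ z l r → nothing-between-levels w i (point z) (lt-at wi refl l) (lt-at refl w1+i r)
    where
    wi : point (index (w , i)) ≡ (w , i)
    wi = point-index w i (≤-trans (n≤1+n i) i<t)
    w1+i : point (index (w , suc i)) ≡ (w , suc i)
    w1+i = point-index w (suc i) i<t

  covers⇒successor : ∀ m n → Covers ord m n → point n ≡ (node m , suc (level m))
  covers⇒successor m n (m<n , nothing-between) with cmpP-lt (node m) (level m) (node n) (level n) (Lt⇒lt m n m<n)
  ... | inj₁ nodes< with subtree-between (node m) (node n) nodes<
  ...   | q , between = ⊥-elim (nothing-between (index (q ++ [] , 0))
                                  (Lt-at refl q0 (cmpP-node< (node m) (level m) (q ++ []) 0 (proj₁ (between []))))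
                                  (Lt-at q0 refl (cmpP-node< (q ++ []) 0 (node n) (level n) (proj₂ (between [])))))
    where
    q0 : point (index (q ++ [] , 0)) ≡ (q ++ [] , 0)
    q0 = point-index (q ++ []) 0 z≤n
  covers⇒successor m n (m<n , nothing-between) | inj₂ (same-node , levels<) with level n ≟ suc (level m)
  ... | yes e = cong₂ _,_ (sym same-node) e
  ... | no ne = ⊥-elim (nothing-between (index (node m , suc (level m)))
                          (Lt-at refl next (cmpP-level< (node m) (level m) (suc (level m)) ≤-refl))
                          (Lt-at next (cong₂ _,_ (sym same-node) refl)
                                 (cmpP-level< (node m) (suc (level m)) (level n) next<n)))
    where
    next<n : suc (level m) < level n
    next<n = ≤∧≢⇒< levels< (λ e → ne (sym e))
    next : point (index (node m , suc (level m))) ≡ (node m , suc (level m))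
    next = point-index (node m) (suc (level m))
             (≤-trans (<⇒≤ next<n) (subst (λ v → level n ≤ t v) (sym same-node) (level≤ n)))

  HasNoPred⇒level≡0 : ∀ n → HasNoPred ord n → level n ≡ 0
  HasNoPred⇒level≡0 n no-pred = by-cases (level n) refl
    where
    by-cases : ∀ l → level n ≡ l → level n ≡ 0
    by-cases zero    e = e
    by-cases (suc j) e = ⊥-elim (no-pred (index (node n , j)) (subst (Covers ord _) index≡n covers))
      where
      covers : Covers ord (index (node n , j)) (index (node n , suc j))
      covers = covers-successor (node n) j (subst (_≤ t (node n)) e (level≤ n))
      index≡n : index (node n , suc j) ≡ n
      index≡n = trans (cong (λ i → index (node n , i)) (sym e)) (index-point n)

  level≡0⇒HasNoPred : ∀ n → level n ≡ 0 → HasNoPred ord n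
  level≡0⇒HasNoPred n e m m⋖n with trans (sym e) (cong proj₂ (covers⇒successor m n m⋖n))
  ... | ()

  HasNoSucc⇒level≡top : ∀ n → HasNoSucc ord n → level n ≡ t (node n)
  HasNoSucc⇒level≡top n no-succ with level n ≟ t (node n)
  ... | yes e   = e
  ... | no  l≢t = ⊥-elim (no-succ (index (node n , suc (level n)))
                    (subst (λ m → Covers ord m (index (node n , suc (level n)))) (index-point n)
                      (covers-successor (node n) (level n) (≤∧≢⇒< (level≤ n) l≢t))))

  level≡top⇒HasNoSucc : ∀ n → level n ≡ t (node n) → HasNoSucc ord n
  level≡top⇒HasNoSucc n e m n⋖m =
    <-irrefl e (subst (λ p → proj₂ p ≤ t (proj₁ p)) (covers⇒successor n m n⋖m) (level≤ m))

  IsFiniteClass⇒point : ∀ {k e} → IsFiniteClass ord k e → ∀ i → i ≤ k → point (e i) ≡ (node (e 0) , i)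
  IsFiniteClass⇒point {e = e} (_ , no-pred , _) zero _ =
    cong (node (e 0) ,_) (HasNoPred⇒level≡0 (e 0) no-pred)
  IsFiniteClass⇒point {e = e} class@(covers , _) (suc i) i<k =
    trans (covers⇒successor (e i) (e (suc i)) (covers i i<k))
          (cong (λ p → proj₁ p , suc (proj₂ p)) (IsFiniteClass⇒point class i (≤-trans (n≤1+n i) i<k)))

  IsFiniteClass⇒length : ∀ {k e} → IsFiniteClass ord k e → k ≡ t (node (e 0))
  IsFiniteClass⇒length {k} {e} class@(_ , _ , no-succ) = begin
    k               ≡⟨ sym (cong proj₂ eₖ) ⟩
    level (e k)     ≡⟨ HasNoSucc⇒level≡top (e k) no-succ ⟩
    t (node (e k))  ≡⟨ cong (λ p → t (proj₁ p)) eₖ ⟩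
    t (node (e 0))  ∎
    where
    eₖ : point (e k) ≡ (node (e 0) , k)
    eₖ = IsFiniteClass⇒point class k ≤-refl

  HasInteriorFiniteClass⇒length : ∀ {k} → HasInteriorFiniteClass lo k → ∃ λ w → k ≡ t w
  HasInteriorFiniteClass⇒length (e , class , _) = node (e 0) , IsFiniteClass⇒length class

  -- Interior because the left and right subtrees of w lie below and above its chain.
  block : ∀ w → HasInteriorFiniteClass lo (t w)
  block w = (λ i → index (w , i))
          , ( (λ i i<t → covers-successor w i i<t)
            , level≡0⇒HasNoPred _ (cong proj₂ bottom)
            , level≡top⇒HasNoSucc _ (trans (cong proj₂ top) (cong (λ p → t (proj₁ p)) (sym top))) )
          , (index (w ++ false ∷ [] , 0)
            , Lt-at left bottom (cmpP-node< (w ++ false ∷ []) 0 w 0 (leftSubtree-< w [])))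
          , (index (w ++ true ∷ [] , 0)
            , Lt-at top right (cmpP-node< w (t w) (w ++ true ∷ []) 0 (<-rightSubtree w [])))
    where
    bottom : point (index (w , 0)) ≡ (w , 0)
    bottom = point-index w 0 z≤n
    top : point (index (w , t w)) ≡ (w , t w)
    top = point-index w (t w) ≤-refl
    left : point (index (w ++ false ∷ [] , 0)) ≡ (w ++ false ∷ [] , 0)
    left = point-index (w ++ false ∷ []) 0 z≤n
    right : point (index (w ++ true ∷ [] , 0)) ≡ (w ++ true ∷ [] , 0)
    right = point-index (w ++ true ∷ []) 0 z≤n

infixl 5 _↾_
_↾_ : (W → ℕ) → W → W → ℕ
(t ↾ q) w = t (q ++ w)

module Subtree {t t′ : W → ℕ} (p : W) (t′≡ : t′ ≗ t ↾ p) where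
  private
    module A = Blocks t′
    module B = Blocks t

  embed : ℕ → ℕ
  embed m = B.index (p ++ A.node m , A.level m)

  point-embed : ∀ m → B.point (embed m) ≡ (p ++ A.node m , A.level m)
  point-embed m = B.point-index _ _ (subst (A.level m ≤_) (t′≡ (A.node m)) (A.level≤ m))

  cmpP-embed : ∀ m n → cmpP (B.point (embed m)) (B.point (embed n)) ≡ cmpP (A.point m) (A.point n)
  cmpP-embed m n = begin
    cmpP (B.point (embed m)) (B.point (embed n))
      ≡⟨ cong₂ cmpP (point-embed m) (point-embed n) ⟩
    lex (cmpW (p ++ A.node m) (p ++ A.node n)) (cmpℕ (A.level m) (A.level n))
      ≡⟨ cong (λ c → lex c (cmpℕ (A.level m) (A.level n))) (cmpW-++ p (A.node m) (A.node n)) ⟩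
    cmpP (A.point m) (A.point n) ∎

  convex : IsConvexImage B.ord embed
  convex m n k m≤k k≤n with subtree-convex p (A.node m) (A.node n) (B.node k)
                                (isLeq-lex _ _ (subst (λ a → isLeq (cmpP a (B.point k)) ≡ true) (point-embed m) m≤k))
                                (isLeq-lex _ _ (subst (λ a → isLeq (cmpP (B.point k) a) ≡ true) (point-embed n) k≤n))
  ... | z , node≡ = A.index (z , B.level k) , (begin
    embed (A.index (z , B.level k))    ≡⟨ cong (λ a → B.index (p ++ proj₁ a , proj₂ a))
                                               (A.point-index z (B.level k) valid) ⟩
    B.index (p ++ z , B.level k)       ≡⟨ cong (λ w → B.index (w , B.level k)) (sym node≡) ⟩
    B.index (B.point k)                ≡⟨ B.index-point k ⟩
    k                                  ∎)
    where
    valid : B.level k ≤ t′ z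
    valid = subst (B.level k ≤_) (trans (cong t node≡) (sym (t′≡ z))) (B.level≤ k)

  isConvexEmbedding : IsConvexEmbedding A.ord B.ord embed
  isConvexEmbedding = (λ m n → subst (_≡ true) (cong isLeq (sym (cmpP-embed m n)))
                             , subst (_≡ true) (cong isLeq (cmpP-embed m n)))
                    , convex

subtree-⊴ : ∀ t t′ p → t′ ≗ t ↾ p → Blocks.lo t′ ⊴ Blocks.lo t
subtree-⊴ t t′ p t′≡ = Subtree.embed {t} {t′} p t′≡ , Subtree.isConvexEmbedding {t} {t′} p t′≡

module _ {t : W → ℕ} {C : Code} (isC : IsLO C) {f : ℕ → ℕ}
         (emb : IsConvexEmbedding C (Blocks.ord t) f) where
  open Blocks t
  private
    module Wc = IsComparison cmpW-isComparison
    w₀ : W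
    w₀ = node (f 0)

  -- Pigeonhole: the t w₀ + 2 distinct points f 0, …, f (t w₀ + 1) do not fit on the chain of w₀.
  not-all-on-w₀ : ¬ (∀ (k : Fin (2 + t w₀)) → node (f (toℕ k)) ≡ w₀)
  not-all-on-w₀ on-w₀ with pigeonhole (n<1+n (suc (t w₀))) (λ k → fromℕ< (level<s k))
    where
    level<s : ∀ k → level (f (toℕ k)) < suc (t w₀)
    level<s k = s≤s (subst (λ w → level (f (toℕ k)) ≤ t w) (on-w₀ k) (level≤ (f (toℕ k))))
  ... | i , j , i<j , same-level =
    <-irrefl (ConvexEmbedding.injective isC isLO emb (toℕ i) (toℕ j)
               (point-injective (f (toℕ i)) (f (toℕ j)) same-point)) i<j
    where
    same-point : point (f (toℕ i)) ≡ point (f (toℕ j))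
    same-point = cong₂ _,_ (trans (on-w₀ i) (sym (on-w₀ j)))
                           (trans (sym (toℕ-fromℕ< _)) (trans (cong toℕ same-level) (toℕ-fromℕ< _)))

  image-meets-two-nodes : ∃₂ λ α β → cmpW (node (f α)) (node (f β)) ≡ lt
  image-meets-two-nodes = orient (toℕ (proj₁ off-w₀)) (proj₂ off-w₀) _ refl
    where
    off-w₀ : ∃ λ (k : Fin (2 + t w₀)) → node (f (toℕ k)) ≢ w₀
    off-w₀ = ¬∀⟶∃¬ (2 + t w₀) _ (λ k → ≡-dec _≟ᵇ_ (node (f (toℕ k))) w₀) not-all-on-w₀
    orient : ∀ n → node (f n) ≢ w₀ → ∀ c → cmpW w₀ (node (f n)) ≡ c →
             ∃₂ λ α β → cmpW (node (f α)) (node (f β)) ≡ lt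
    orient n _    lt e = 0 , n , e
    orient n n≢w₀ eq e = ⊥-elim (n≢w₀ (sym (Wc.eq⇒≡ w₀ (node (f n)) e)))
    orient n _    gt e = n , 0 , trans (Wc.swap-opposite w₀ (node (f n))) (cong opposite e)

  subtree-between-in-image : ∀ α β → cmpW (node (f α)) (node (f β)) ≡ lt →
                             ∃ λ q → ∀ x i → i ≤ t (q ++ x) → ∃ λ j → f j ≡ index (q ++ x , i)
  subtree-between-in-image α β α<β = q , in-image
    where
    q : W
    q = proj₁ (subtree-between (node (f α)) (node (f β)) α<β)
    between : SubtreeBetween (node (f α)) (node (f β)) q
    between = proj₂ (subtree-between (node (f α)) (node (f β)) α<β)
    in-image : ∀ x i → i ≤ t (q ++ x) → ∃ λ j → f j ≡ index (q ++ x , i)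
    in-image x i valid = proj₂ emb α β (index (q ++ x , i)) (proj₁ α<qx) (proj₁ qx<β)
      where
      qx : point (index (q ++ x , i)) ≡ (q ++ x , i)
      qx = point-index (q ++ x) i valid
      α<qx : Lt ord (f α) (index (q ++ x , i))
      α<qx = Lt-at refl qx (cmpP-node< (node (f α)) (level (f α)) (q ++ x) i (proj₁ (between x)))
      qx<β : Lt ord (index (q ++ x , i)) (f β)
      qx<β = Lt-at qx refl (cmpP-node< (q ++ x) i (node (f β)) (level (f β)) (proj₂ (between x)))

  image-contains-subtree : ∃ λ q → ∀ x i → i ≤ t (q ++ x) → ∃ λ j → f j ≡ index (q ++ x , i)
  image-contains-subtree =
    subtree-between-in-image (proj₁ image-meets-two-nodes) (proj₁ (proj₂ image-meets-two-nodes))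
                             (proj₂ (proj₂ image-meets-two-nodes))

⊴Blocks⇒subtree : ∀ t {L} → L ⊴ Blocks.lo t → ∃ λ q → Blocks.lo (t ↾ q) ⊴ L
⊴Blocks⇒subtree t {L} (f , emb) =
  q , ⊴-pullback {Blocks.lo (t ↾ q)} {Blocks.lo t} {L} (Subtree.isConvexEmbedding {t} q (λ _ → refl)) emb
                 (λ m → in-image (Blocks.node (t ↾ q) m) (Blocks.level (t ↾ q) m) (Blocks.level≤ (t ↾ q) m))
  where
  subtree-in-image : ∃ λ q → ∀ x i → i ≤ t (q ++ x) → ∃ λ j → f j ≡ Blocks.index t (q ++ x , i)
  subtree-in-image = image-contains-subtree {t} (proj₂ L) emb
  q : W
  q = proj₁ subtree-in-image
  in-image : ∀ x i → i ≤ t (q ++ x) → ∃ λ j → f j ≡ Blocks.index t (q ++ x , i)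
  in-image = proj₂ subtree-in-image

-- Minimal orders

-- An order below Blocks t lies above Blocks (t ↾ q) for some q, which lies above Blocks t.
selfSimilar⇒Minimal : ∀ t → (∀ q → ∃ λ r → t ≗ t ↾ q ↾ r) → Minimal (Blocks.lo t)
selfSimilar⇒Minimal t self-similar L L⊴ =
  ⊴-trans {Blocks.lo t} {Blocks.lo (t ↾ q)} {L} (subtree-⊴ (t ↾ q) t r t≗) subtree⊴L
  where
  q : W
  q = proj₁ (⊴Blocks⇒subtree t {L} L⊴)
  subtree⊴L : Blocks.lo (t ↾ q) ⊴ L
  subtree⊴L = proj₂ (⊴Blocks⇒subtree t {L} L⊴)
  r : W
  r = proj₁ (self-similar q)
  t≗ : t ≗ t ↾ q ↾ r
  t≗ = proj₂ (self-similar q)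

step : Bool → ℤ
step false = -1ℤ
step true  = 1ℤ

drift : W → ℤ
drift []      = 0ℤ
drift (b ∷ w) = step b ℤ.+ drift w

drift-++ : ∀ p w → drift (p ++ w) ≡ drift p ℤ.+ drift w
drift-++ []      w = sym (ℤ.+-identityˡ (drift w))
drift-++ (b ∷ p) w =
  trans (cong (λ d → step b ℤ.+ d) (drift-++ p w)) (sym (ℤ.+-assoc (step b) (drift p) (drift w)))

drift-map-not : ∀ w → drift (map not w) ≡ ℤ.- drift w
drift-map-not []      = refl
drift-map-not (b ∷ w) = begin
  step (not b) ℤ.+ drift (map not w)  ≡⟨ cong₂′ (step-not b) (drift-map-not w) ⟩
  ℤ.- step b ℤ.+ ℤ.- drift w          ≡⟨ sym (ℤ.neg-distrib-+ (step b) (drift w)) ⟩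
  ℤ.- (step b ℤ.+ drift w)            ∎
  where
  step-not : ∀ b → step (not b) ≡ ℤ.- step b
  step-not false = refl
  step-not true  = refl
  cong₂′ : ∀ {a b c d} → a ≡ b → c ≡ d → a ℤ.+ c ≡ b ℤ.+ d
  cong₂′ refl refl = refl

drift-balanced : ∀ q w → drift w ≡ drift (q ++ map not q ++ w)
drift-balanced q w = sym (begin
  drift (q ++ map not q ++ w)                    ≡⟨ drift-++ q (map not q ++ w) ⟩
  drift q ℤ.+ drift (map not q ++ w)             ≡⟨ cong (λ d → drift q ℤ.+ d) (drift-++ (map not q) w) ⟩
  drift q ℤ.+ (drift (map not q) ℤ.+ drift w)    ≡⟨ cong (λ d → drift q ℤ.+ (d ℤ.+ drift w)) (drift-map-not q) ⟩
  drift q ℤ.+ (ℤ.- drift q ℤ.+ drift w)          ≡⟨ sym (ℤ.+-assoc (drift q) (ℤ.- drift q) (drift w)) ⟩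
  (drift q ℤ.+ ℤ.- drift q) ℤ.+ drift w          ≡⟨ cong (λ d → d ℤ.+ drift w) (ℤ.+-inverseʳ (drift q)) ⟩
  0ℤ ℤ.+ drift w                                 ≡⟨ ℤ.+-identityˡ (drift w) ⟩
  drift w                                        ∎)

drift-replicate-true : ∀ k → drift (replicate k true) ≡ + k
drift-replicate-true zero    = refl
drift-replicate-true (suc k) = cong (λ d → 1ℤ ℤ.+ d) (drift-replicate-true k)

bit : Bool → ℕ
bit false = 0
bit true  = 1

double : ℕ → ℕ
double zero    = zero
double (suc k) = suc (suc (double k))

double+bit-injective : ∀ k j a b → double k + bit a ≡ double j + bit b → k ≡ j × a ≡ b
double+bit-injective zero    zero    false false _ = refl , refl
double+bit-injective zero    zero    true  true  _ = refl , refl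
double+bit-injective (suc k) (suc j) a     b     e with double+bit-injective k j a b (suc-injective (suc-injective e))
... | refl , a≡b = refl , a≡b
double+bit-injective zero    zero    false true  ()
double+bit-injective zero    zero    true  false ()
double+bit-injective zero    (suc j) false b     ()
double+bit-injective zero    (suc j) true  b     ()
double+bit-injective (suc k) zero    a     false ()
double+bit-injective (suc k) zero    a     true  ()

-- Nodes of drift k ≥ 0 carry chains whose length encodes the pair (k , x k).
label : (ℕ → Bool) → ℤ → ℕ
label x (+ k)     = suc (double k + bit (x k))
label x -[1+ _ ]  = 0

label-determines : ∀ x y k c → label x (+ k) ≡ label y c → x k ≡ y k
label-determines x y k (+ j) e with double+bit-injective k j (x k) (y j) (suc-injective e)
... | refl , xk≡yk = xk≡yk

labelling : (ℕ → Bool) → W → ℕ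
labelling x w = label x (drift w)

M : (ℕ → Bool) → LO
M x = Blocks.lo (labelling x)

M-minimal : ∀ x → Minimal (M x)
M-minimal x = selfSimilar⇒Minimal (labelling x) λ q → map not q , λ w → cong (label x) (drift-balanced q w)

M-⊴⇒≗ : ∀ x y → M x ⊴ M y → x ≗₂ y
M-⊴⇒≗ x y Mx⊴My k = label-determines x y k (drift (proj₁ node-of-class)) length≡
  where
  node-of-class : ∃ λ w → labelling x (replicate k true) ≡ labelling y w
  node-of-class = Blocks.HasInteriorFiniteClass⇒length (labelling y)
    (HasInteriorFiniteClass-⊴ {M x} {M y} Mx⊴My (Blocks.block (labelling x) (replicate k true)))
  length≡ : label x (+ k) ≡ labelling y (proj₁ node-of-class)
  length≡ = trans (cong (label x) (sym (drift-replicate-true k))) (proj₂ node-of-class)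

M-incomparable : ∀ x y → ¬ (x ≗₂ y) → Incomparable (M x) (M y)
M-incomparable x y x≉y = (λ Mx⊴My → x≉y (M-⊴⇒≗ x y Mx⊴My))
                       , (λ My⊴Mx → x≉y (λ k → sym (M-⊴⇒≗ y x My⊴Mx k)))

-- A decreasing sequence without lower bound

leadingTrues : W → ℕ
leadingTrues []          = 0
leadingTrues (true ∷ w)  = suc (leadingTrues w)
leadingTrues (false ∷ w) = 0

shifted : ℕ → W → ℕ
shifted n w = leadingTrues w + n

S : ℕ → LO
S n = Blocks.lo (shifted n)

S-suc-⊴ : ∀ n → S (suc n) ⊴ S n
S-suc-⊴ n = subtree-⊴ (shifted n) (shifted (suc n)) (true ∷ []) λ w → +-suc (leadingTrues w) n

S-classes-≥ : ∀ n {k} → HasInteriorFiniteClass (S n) k → n ≤ k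
S-classes-≥ n class with Blocks.HasInteriorFiniteClass⇒length (shifted n) class
... | w , refl = m≤n+m n (leadingTrues w)

S-⋬-suc : ∀ n → ¬ (S n ⊴ S (suc n))
S-⋬-suc n Sn⊴S1+n =
  1+n≰n (S-classes-≥ (suc n) (HasInteriorFiniteClass-⊴ {S n} {S (suc n)} Sn⊴S1+n (Blocks.block (shifted n) [])))

-- A lower bound L lies above some Blocks (shifted 0 ↾ q), so it has an interior finite class of
-- some length k, and then so does S (suc k).
S-unbounded : ¬ BoundedBelow S
S-unbounded (L , L⊴S) =
  1+n≰n (S-classes-≥ (suc k) (HasInteriorFiniteClass-⊴ {L} {S (suc k)} (L⊴S (suc k)) class))
  where
  q : W
  q = proj₁ (⊴Blocks⇒subtree (shifted 0) {L} (L⊴S 0))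
  k : ℕ
  k = (shifted 0 ↾ q) []
  class : HasInteriorFiniteClass L k
  class = HasInteriorFiniteClass-⊴ {Blocks.lo (shifted 0 ↾ q)} {L}
            (proj₂ (⊴Blocks⇒subtree (shifted 0) {L} (L⊴S 0))) (Blocks.block (shifted 0 ↾ q) [])

module Pairs = SumEnumeration (λ u → u)

unpair : ℕ → ℕ × ℕ
unpair N = proj₂ (Pairs.unrank N) , proj₁ (Pairs.unrank N) ∸ proj₂ (Pairs.unrank N)

unpair-rank : ∀ m n → unpair (Pairs.rank (m + n , m)) ≡ (m , n)
unpair-rank m n rewrite Pairs.unrank-rank (m + n) m (m≤m+n m n) = cong (m ,_) (m+n∸m≡n m n)

≐⇒⊴ : ∀ {L L′} → L ≐ L′ → L ⊴ L′
≐⇒⊴ L≐L′ = (λ m → m) , (λ m n → trans (sym (L≐L′ m n)) , trans (L≐L′ m n)) , λ _ _ k _ _ → k , refl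

-- The members of a basis below the M x are pairwise distinct, since M x is minimal and the M x
-- are incomparable; conversely an order is determined by its code, a real.
basis-size : ∀ B → IsBasis B → HasContinuumSize B
basis-size B basis = (F , F-injective) , (G , G-injective)
  where
  member : (ℕ → Bool) → LO
  member x = proj₁ (basis (M x))
  member⊴M : ∀ x → member x ⊴ M x
  member⊴M x = proj₂ (proj₂ (basis (M x)))
  F : (ℕ → Bool) → Σ LO B
  F x = member x , proj₁ (proj₂ (basis (M x)))
  F-injective : ∀ x y → member x ≐ member y → x ≗₂ y
  F-injective x y member≐ =
    M-⊴⇒≗ x y (⊴-trans {M x} {member x} {M y} (M-minimal x (member x) (member⊴M x))
                (⊴-trans {member x} {member y} {M y} (≐⇒⊴ {member x} {member y} member≐) (member⊴M y)))
  G : Σ LO B → ℕ → Bool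
  G (L , _) N = code L (proj₁ (unpair N)) (proj₂ (unpair N))
  G-injective : ∀ a b → G a ≗₂ G b → proj₁ a ≐ proj₁ b
  G-injective a b Ga≗Gb m n = trans (sym (G-at a)) (trans (Ga≗Gb N) (G-at b))
    where
    N : ℕ
    N = Pairs.rank (m + n , m)
    G-at : ∀ c → G c N ≡ code (proj₁ c) m n
    G-at (L , _) = cong (λ p → code L (proj₁ p) (proj₂ p)) (unpair-rank m n)

proposition3p9 :
    -- (a) continuum many pairwise incomparable minimal elements
    (Σ ((ℕ → Bool) → LO) λ M →
        (∀ x → Minimal (M x))
        × (∀ x y → ¬ (x ≗₂ y) → Incomparable (M x) (M y)))
    -- (a, in particular) every basis has size 2^ℵ0
    × (∀ (B : LO → Set) → IsBasis B → HasContinuumSize B)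
    -- (b) a strictly decreasing ω-sequence not bounded from below
    × (Σ (ℕ → LO) λ s →
        (∀ n → StrictlyBelow (s (suc n)) (s n)) × ¬ BoundedBelow s)
proposition3p9 =
  (M , M-minimal , M-incomparable) ,
  basis-size ,
  (S , (λ n → S-suc-⊴ n , S-⋬-suc n) , S-unbounded)
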